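{- If $G$ is a cycle with an even number $n\ge 4$ of vertices, then its Mycielskian $\mu(G)$ is not Hamilton-connected.
   Context: For a graph $G$ with vertex set $X=\{x_1,\dots,x_n\}$, the Mycielskian $\mu(G)$ has vertex set $X\cup Y\cup\{z\}$ with $Y=\{y_1,\dots,y_n\}$ new vertices and $z$ a new vertex; its edges are the edges of $G$, the edges $zy_i$ for all $i$, and the edges $x_iy_j$ and $x_jy_i$ for every edge $x_ix_j$ of $G$. A graph is Hamilton-connected if for every pair of distinct vertices $u,v$ there is a Hamiltonian path from $u$ to $v$. -}

module Defs where

open import Level using (Level; 0ℓ; _⊔_) renaming (suc to lsuc)
open import Data.Nat using (ℕ; zero; suc; _+_; _%_; NonZero)
open import Data.Fin using (Fin; toℕ)
open import Data.Sum using (_⊎_; inj₁; inj₂)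
open import Data.Unit using (⊤; tt)
open import Data.Empty using (⊥)
open import Data.Product using (_×_; _,_; ∃-syntax)
open import Data.List using (List; []; _∷_)
open import Data.List.Membership.Propositional using (_∈_)
open import Data.List.Relation.Unary.Unique.Propositional using (Unique)
open import Relation.Binary.PropositionalEquality using (_≡_)
open import Relation.Nullary using (¬_)

-- The cycle C_n on vertices Fin n (used for n ≥ 3): i ~ j iff j ≡ i+1 (mod n) or i ≡ j+1 (mod n).
-- (suc (n ∸ 1) = n for n ≥ 1; written this way to avoid a NonZero instance.)
CycleAdj : (n : ℕ) → Fin n → Fin n → Set
CycleAdj n i j = (toℕ j ≡ (suc (toℕ i)) % suc n') ⊎ (toℕ i ≡ (suc (toℕ j)) % suc n')
  where
    n' : ℕ
    n' = n Data.Nat.∸ 1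

-- Mycielskian vertex set: X = inj₁ x, Y = inj₂ (inj₁ y), z = inj₂ (inj₂ tt).
MV : Set → Set
MV V = V ⊎ (V ⊎ ⊤)

MAdj : {V : Set} → (V → V → Set) → MV V → MV V → Set
MAdj A (inj₁ x)          (inj₁ x')         = A x x'
MAdj A (inj₁ x)          (inj₂ (inj₁ y))   = A x y
MAdj A (inj₁ x)          (inj₂ (inj₂ _))   = ⊥
MAdj A (inj₂ (inj₁ y))   (inj₁ x)          = A y x
MAdj A (inj₂ (inj₁ y))   (inj₂ (inj₁ y'))  = ⊥
MAdj A (inj₂ (inj₁ y))   (inj₂ (inj₂ _))   = ⊤
MAdj A (inj₂ (inj₂ _))   (inj₁ x)          = ⊥
MAdj A (inj₂ (inj₂ _))   (inj₂ (inj₁ y))   = ⊤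
MAdj A (inj₂ (inj₂ _))   (inj₂ (inj₂ _))   = ⊥

data IsWalk {V : Set} (A : V → V → Set) : List V → Set where
  walk-nil  : IsWalk A []
  walk-one  : ∀ v → IsWalk A (v ∷ [])
  walk-cons : ∀ u v vs → A u v → IsWalk A (v ∷ vs) → IsWalk A (u ∷ v ∷ vs)

data StartsEnds {V : Set} : List V → V → V → Set where
  se-one  : ∀ v → StartsEnds (v ∷ []) v v
  se-cons : ∀ u w ws v → StartsEnds (w ∷ ws) w v → StartsEnds (u ∷ w ∷ ws) u v

HamPath : {V : Set} → (V → V → Set) → V → V → Set
HamPath {V} A u v = ∃[ p ] (IsWalk A p × Unique p × (∀ w → w ∈ p) × StartsEnds p u v)

HamiltonConnected : {V : Set} → (V → V → Set) → Set
HamiltonConnected {V} A = ∀ (u v : V) → ¬ (u ≡ v) → HamPath A u v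

-- After z, a Hamiltonian path of μ(G) from z to some x has to cover all of X ∪ Y without
-- returning to z. The y-vertices are pairwise non-adjacent there, so in a path ending in X
-- every y is followed by an x; as there are as many y's as x's, the path must alternate
-- y x y x … y x. In a bipartite G, consecutive y's of such a path lie in the same colour
-- class, so all of Y would be monochromatic, which is impossible as soon as G has an edge.
-- Even cycles are bipartite, hence μ(C_n) has no Hamiltonian path from z to x₀.
module Submission where

open import Defs
open import Data.Nat using (ℕ; suc; _≤_; _<_; _%_; z≤n; s≤s; s≤s⁻¹; parity)
open import Data.Nat.Properties using (m<n⇒m<1+n; m≤n⇒m<n∨m≡n; ≤⇒≯; ≤-reflexive)
open import Data.Nat.DivMod using (n%n≡0; m<n⇒m%n≡m)
open import Data.Nat.Divisibility using (_∣_; divides)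
open import Data.Parity.Base using (Parity; 0ℙ; _⁻¹)
open import Data.Parity.Properties using (⁻¹-selfInverse; p≢p⁻¹; suc-homo-⁻¹; *-homo-*; *-zeroʳ)
open import Data.Fin using (toℕ) renaming (zero to fzero; suc to fsuc)
open import Data.Fin.Properties using (toℕ<n)
open import Data.Sum using (_⊎_; inj₁; inj₂)
open import Data.Unit using (tt)
open import Data.Product using (_,_)
open import Data.List using (List; []; _∷_; length)
open import Data.List.Membership.Propositional using (_∈_)
open import Data.List.Membership.Propositional.Properties.WithK using (unique∧set⇒bag)
open import Data.List.Relation.Binary.BagAndSetEquality using (∼bag⇒↭)
open import Data.List.Relation.Binary.Permutation.Propositional.Properties using (↭-length)
open import Data.List.Relation.Unary.Any using (here; there)
open import Data.List.Relation.Unary.All as All using (All; []; _∷_; lookup)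
open import Data.List.Relation.Unary.AllPairs using ([]; _∷_)
open import Data.List.Relation.Unary.Unique.Propositional using (Unique)
open import Function using (_∘_)
open import Function.Bundles using (mk⇔)
open import Relation.Binary.PropositionalEquality
  using (_≡_; _≢_; refl; sym; trans; cong; module ≡-Reasoning)
open import Relation.Nullary using (¬_; contradiction)

lefts : {A B : Set} → List (A ⊎ B) → List A
lefts []            = []
lefts (inj₁ a ∷ vs) = a ∷ lefts vs
lefts (inj₂ _ ∷ vs) = lefts vs

rights : {A B : Set} → List (A ⊎ B) → List B
rights []            = []
rights (inj₁ _ ∷ vs) = rights vs
rights (inj₂ b ∷ vs) = b ∷ rights vs

module _ {A B : Set} where

  ∈-lefts⁺ : ∀ {a} {vs : List (A ⊎ B)} → inj₁ a ∈ vs → a ∈ lefts vs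
  ∈-lefts⁺ {vs = inj₁ _ ∷ _} (here refl) = here refl
  ∈-lefts⁺ {vs = inj₁ _ ∷ _} (there a∈) = there (∈-lefts⁺ a∈)
  ∈-lefts⁺ {vs = inj₂ _ ∷ _} (there a∈) = ∈-lefts⁺ a∈

  ∈-rights⁺ : ∀ {b} {vs : List (A ⊎ B)} → inj₂ b ∈ vs → b ∈ rights vs
  ∈-rights⁺ {vs = inj₂ _ ∷ _} (here refl) = here refl
  ∈-rights⁺ {vs = inj₁ _ ∷ _} (there b∈) = ∈-rights⁺ b∈
  ∈-rights⁺ {vs = inj₂ _ ∷ _} (there b∈) = there (∈-rights⁺ b∈)

  All-lefts⁺ : ∀ {P : A ⊎ B → Set} {vs} → All P vs → All (P ∘ inj₁) (lefts vs)
  All-lefts⁺ {vs = []}         []       = []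
  All-lefts⁺ {vs = inj₁ _ ∷ _} (p ∷ ps) = p ∷ All-lefts⁺ ps
  All-lefts⁺ {vs = inj₂ _ ∷ _} (_ ∷ ps) = All-lefts⁺ ps

  All-rights⁺ : ∀ {P : A ⊎ B → Set} {vs} → All P vs → All (P ∘ inj₂) (rights vs)
  All-rights⁺ {vs = []}         []       = []
  All-rights⁺ {vs = inj₁ _ ∷ _} (_ ∷ ps) = All-rights⁺ ps
  All-rights⁺ {vs = inj₂ _ ∷ _} (p ∷ ps) = p ∷ All-rights⁺ ps

  Unique-lefts⁺ : {vs : List (A ⊎ B)} → Unique vs → Unique (lefts vs)
  Unique-lefts⁺ {[]}         []       = []
  Unique-lefts⁺ {inj₁ _ ∷ _} (d ∷ ds) = All.map (_∘ cong inj₁) (All-lefts⁺ d) ∷ Unique-lefts⁺ ds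
  Unique-lefts⁺ {inj₂ _ ∷ _} (_ ∷ ds) = Unique-lefts⁺ ds

  Unique-rights⁺ : {vs : List (A ⊎ B)} → Unique vs → Unique (rights vs)
  Unique-rights⁺ {[]}         []       = []
  Unique-rights⁺ {inj₁ _ ∷ _} (_ ∷ ds) = Unique-rights⁺ ds
  Unique-rights⁺ {inj₂ _ ∷ _} (d ∷ ds) = All.map (_∘ cong inj₂) (All-rights⁺ d) ∷ Unique-rights⁺ ds

length-unique-covering : {V : Set} {us vs : List V} → Unique us → Unique vs →
                         (∀ w → w ∈ us) → (∀ w → w ∈ vs) → length us ≡ length vs
length-unique-covering du dv cu cv =
  ↭-length (∼bag⇒↭ (unique∧set⇒bag du dv (λ {w} → mk⇔ (λ _ → cv w) (λ _ → cu w))))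

ProperTwoColouring : {V : Set} → (V → V → Set) → (V → Parity) → Set
ProperTwoColouring A c = ∀ {u v} → A u v → c v ≡ c u ⁻¹

properTwoColouring-sameColour : {V : Set} {A : V → V → Set} {c : V → Parity} →
                                ProperTwoColouring A c →
                                ∀ {u v w} → A u v → A v w → c w ≡ c u
properTwoColouring-sameColour proper uv vw = trans (proper vw) (⁻¹-selfInverse (sym (proper uv)))

pattern X v = inj₁ v
pattern Y v = inj₂ (inj₁ v)
pattern Z   = inj₂ (inj₂ tt)

module Mycielskian {V : Set} (A : V → V → Set) where

  μ : MV V → MV V → Set
  μ = MAdj A

  xs : List (MV V) → List V
  xs = lefts

  ys : List (MV V) → List V
  ys = lefts ∘ rights

  mutual
    length-ys<xs : ∀ {x e L} → IsWalk μ (X x ∷ L) → All (Z ≢_) L →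
                   StartsEnds (X x ∷ L) (X x) (X e) →
                   length (ys (X x ∷ L)) < length (xs (X x ∷ L))
    length-ys<xs {L = []}      _ _ _ = s≤s z≤n
    length-ys<xs {L = X _ ∷ _} (walk-cons _ _ _ _ w) (_ ∷ nz) (se-cons _ _ _ _ se) =
      m<n⇒m<1+n (length-ys<xs w nz se)
    length-ys<xs {L = Y _ ∷ _} (walk-cons _ _ _ _ w) (_ ∷ nz) (se-cons _ _ _ _ se) =
      s≤s (length-ys≤xs w nz se)
    length-ys<xs {L = Z ∷ _}   _ (z≢z ∷ _) _ = contradiction refl z≢z

    length-ys≤xs : ∀ {y e L} → IsWalk μ (Y y ∷ L) → All (Z ≢_) L →
                   StartsEnds (Y y ∷ L) (Y y) (X e) →
                   length (ys (Y y ∷ L)) ≤ length (xs (Y y ∷ L))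
    length-ys≤xs {L = []}      _ _ ()
    length-ys≤xs {L = X _ ∷ _} (walk-cons _ _ _ _ w) (_ ∷ nz) (se-cons _ _ _ _ se) =
      length-ys<xs w nz se
    length-ys≤xs {L = Y _ ∷ _} (walk-cons _ _ _ () _) _ _
    length-ys≤xs {L = Z ∷ _}   _ (z≢z ∷ _) _ = contradiction refl z≢z

  module _ {c : V → Parity} (proper : ProperTwoColouring A c) where

    -- A walk with #Y ≥ #X cannot contain two consecutive x's, so it alternates y x y x ….
    balanced-ys-monochromatic : ∀ {y e L} → IsWalk μ (Y y ∷ L) → All (Z ≢_) L →
                                StartsEnds (Y y ∷ L) (Y y) (X e) →
                                length (xs (Y y ∷ L)) ≤ length (ys (Y y ∷ L)) →
                                All (λ w → c w ≡ c y) (ys (Y y ∷ L))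
    balanced-ys-monochromatic {L = []} _ _ () _
    balanced-ys-monochromatic {L = X _ ∷ []} _ _ _ _ = refl ∷ []
    balanced-ys-monochromatic {L = X _ ∷ X _ ∷ _}
      (walk-cons _ _ _ _ (walk-cons _ _ _ _ w)) (_ ∷ _ ∷ nz)
      (se-cons _ _ _ _ (se-cons _ _ _ _ se)) xs≤ys =
      contradiction (s≤s⁻¹ xs≤ys) (≤⇒≯ (s≤s⁻¹ (length-ys<xs w nz se)))
    balanced-ys-monochromatic {L = X _ ∷ Y _ ∷ _}
      (walk-cons _ _ _ yx (walk-cons _ _ _ xy′ w)) (_ ∷ _ ∷ nz)
      (se-cons _ _ _ _ (se-cons _ _ _ _ se)) xs≤ys =
      refl ∷ All.map (λ eq → trans eq (properTwoColouring-sameColour {A = A} proper yx xy′))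
                     (balanced-ys-monochromatic w nz se (s≤s⁻¹ xs≤ys))
    balanced-ys-monochromatic {L = X _ ∷ Z ∷ _} _ (_ ∷ z≢z ∷ _) _ _ = contradiction refl z≢z
    balanced-ys-monochromatic {L = Y _ ∷ _} (walk-cons _ _ _ () _) _ _ _
    balanced-ys-monochromatic {L = Z ∷ _} _ (z≢z ∷ _) _ _ = contradiction refl z≢z

    ¬HamPath-z-x : ∀ {u v e} → A u v → ¬ HamPath μ Z (X e)
    ¬HamPath-z-x {u} {v} uv
      (_ , walk-cons _ (Y y) L _ w , d@((_ ∷ nz) ∷ _) , covers , se-cons _ _ _ _ se) =
      p≢p⁻¹ (c u) (trans (trans (lookup mono (∈-ys u)) (sym (lookup mono (∈-ys v)))) (proper uv))
      where
        ∈-ys : ∀ w → w ∈ ys (Y y ∷ L)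
        ∈-ys w = ∈-lefts⁺ (∈-rights⁺ (covers (Y w)))

        ∈-xs : ∀ w → w ∈ xs (Y y ∷ L)
        ∈-xs w = ∈-lefts⁺ (covers (X w))

        mono : All (λ w → c w ≡ c y) (ys (Y y ∷ L))
        mono = balanced-ys-monochromatic w nz se (≤-reflexive
          (length-unique-covering (Unique-lefts⁺ d) (Unique-lefts⁺ (Unique-rights⁺ d)) ∈-xs ∈-ys))
    ¬HamPath-z-x _ (_ , walk-cons _ (X _) _ () _ , _ , _ , se-cons _ _ _ _ _)
    ¬HamPath-z-x _ (_ , walk-cons _ Z _ () _ , _ , _ , se-cons _ _ _ _ _)

    bipartite⇒¬HamiltonConnected : ∀ {u v} → A u v → ¬ HamiltonConnected μ
    bipartite⇒¬HamiltonConnected {u} uv hc = ¬HamPath-z-x uv (hc Z (X u) λ ())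

parity-suc : ∀ n → parity (suc n) ≡ parity n ⁻¹
parity-suc n = sym (⁻¹-selfInverse (suc-homo-⁻¹ n))

parity-suc-mod : ∀ {i m} → i < suc m → parity (suc m) ≡ 0ℙ →
                 parity (suc i % suc m) ≡ parity i ⁻¹
parity-suc-mod {i} {m} i<1+m even with m≤n⇒m<n∨m≡n i<1+m
... | inj₁ 1+i<1+m = trans (cong parity (m<n⇒m%n≡m 1+i<1+m)) (parity-suc i)
... | inj₂ 1+i≡1+m = begin
  parity (suc i % suc m) ≡⟨ cong (λ k → parity (k % suc m)) 1+i≡1+m ⟩
  parity (suc m % suc m) ≡⟨ cong parity (n%n≡0 (suc m)) ⟩
  0ℙ                     ≡⟨ sym even ⟩
  parity (suc m)         ≡⟨ cong parity (sym 1+i≡1+m) ⟩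
  parity (suc i)         ≡⟨ parity-suc i ⟩
  parity i ⁻¹            ∎
  where open ≡-Reasoning

CycleAdj-properTwoColouring : ∀ {m} → parity (suc m) ≡ 0ℙ →
                              ProperTwoColouring (CycleAdj (suc m)) (parity ∘ toℕ)
CycleAdj-properTwoColouring even {i} {j} (inj₁ j≡1+i) =
  trans (cong parity j≡1+i) (parity-suc-mod (toℕ<n i) even)
CycleAdj-properTwoColouring even {i} {j} (inj₂ i≡1+j) =
  sym (⁻¹-selfInverse (sym (trans (cong parity i≡1+j) (parity-suc-mod (toℕ<n j) even))))

CycleAdj-0-1 : ∀ k → CycleAdj (suc (suc k)) fzero (fsuc fzero)
CycleAdj-0-1 k = inj₁ (sym (m<n⇒m%n≡m {n = suc (suc k)} (s≤s (s≤s z≤n))))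

parity-even : ∀ {n} → 2 ∣ n → parity n ≡ 0ℙ
parity-even (divides q refl) = trans (*-homo-* q 2) (*-zeroʳ (parity q))

proposition15 : (n : ℕ) → 4 ≤ n → 2 ∣ n → ¬ HamiltonConnected (MAdj (CycleAdj n))
proposition15 (suc (suc k)) (s≤s (s≤s _)) 2∣n =
  Mycielskian.bipartite⇒¬HamiltonConnected (CycleAdj (suc (suc k)))
    (CycleAdj-properTwoColouring (parity-even 2∣n)) (CycleAdj-0-1 k)
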